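{- Let $G$ be a triangle-free graph and let $\sigma$ be a sequence of $l$ vertex splits applied to $G$ whose resulting graph is an interval graph (respectively, a unit interval graph, respectively, a chordal graph). Then there exists a sequence of at most $l$ exclusive vertex splits applied to $G$ whose resulting graph is an interval graph (respectively, a unit interval graph, respectively, a chordal graph).
   Context: All graphs are finite, simple and undirected. A (vertex) split of a vertex $v$ of a graph $G$ chooses sets $A,B\subseteq N_G(v)$ with $A\cup B=N_G(v)$ and replaces $v$ by two new vertices $v_1,v_2$, where $v_1$ is adjacent exactly to $A$ and $v_2$ exactly to $B$ (all other adjacencies unchanged). The split is exclusive if moreover $A\cap B=\emptyset$. A split sequence applies splits one after another, each to a vertex of the current graph. An interval graph is the intersection graph of intervals on the real line; a unit interval graph is the intersection graph of unit-length intervals; a chordal graph is a graph with no induced cycle of length at least $4$.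
   Formalization: The intervals defining interval and unit interval graphs are closed intervals with rational endpoints instead of intervals on the real line. -}

module Defs where

open import Data.Nat as ℕ using (ℕ; zero; suc; _+_; _%_)
open import Data.Bool using (Bool; true; false; _∨_; _∧_)
open import Data.Fin using (Fin; toℕ; inject₁; fromℕ)
open import Data.Product using (Σ; ∃; ∃-syntax; _×_; _,_)
open import Data.Sum using (_⊎_)
open import Data.Empty using (⊥)
open import Relation.Nullary using (¬_)
open import Relation.Binary.PropositionalEquality using (_≡_; _≢_)
open import Function.Definitions using (Injective)
open import Data.Rational as ℚ using (ℚ; 1ℚ)

record Graph (n : ℕ) : Set where
  field
    adj    : Fin n → Fin n → Bool
    sym    : ∀ i j → adj i j ≡ adj j i
    irrefl : ∀ i → adj i i ≡ false
open Graph public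

Subset : ℕ → Set
Subset n = Fin n → Bool

-- Triangle-free: no three pairwise adjacent vertices
-- (adjacency implies distinctness, by irreflexivity).
TriangleFree : ∀ {n} → Graph n → Set
TriangleFree {n} G = (i j k : Fin n) →
  adj G i j ≡ true → adj G j k ≡ true → adj G i k ≡ true → ⊥

-- In the result H (on Fin (suc n)) the copy v₁ is inject₁ v, the copy v₂ is
-- the new last vertex fromℕ n; every other vertex x of G is inject₁ x.
-- (H is determined by these conditions together with symmetry/irreflexivity.)
record SplitData {n : ℕ} (G : Graph n) (H : Graph (suc n)) : Set where
  field
    v     : Fin n
    A B   : Subset n
    union : ∀ u → (A u ∨ B u) ≡ adj G v u
    keep  : ∀ x y → x ≢ v → y ≢ v → adj H (inject₁ x) (inject₁ y) ≡ adj G x y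
    v₁adj : ∀ y → y ≢ v → adj H (inject₁ v) (inject₁ y) ≡ A y
    v₂adj : ∀ y → y ≢ v → adj H (fromℕ n) (inject₁ y) ≡ B y
    v₁v₂  : adj H (inject₁ v) (fromℕ n) ≡ false

IsSplit : ∀ {n} → Graph n → Graph (suc n) → Set
IsSplit G H = SplitData G H

IsExclusiveSplit : ∀ {n} → Graph n → Graph (suc n) → Set
IsExclusiveSplit G H =
  Σ (SplitData G H) λ s → ∀ u → (SplitData.A s u ∧ SplitData.B s u) ≡ false

data SplitSeq : ∀ {n m} → Graph n → ℕ → Graph m → Set where
  done : ∀ {n} {G : Graph n} → SplitSeq G 0 G
  step : ∀ {n m l} {G : Graph n} {G' : Graph (suc n)} {H : Graph m} →
         IsSplit G G' → SplitSeq G' l H → SplitSeq G (suc l) H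

data ExclusiveSplitSeq : ∀ {n m} → Graph n → ℕ → Graph m → Set where
  done : ∀ {n} {G : Graph n} → ExclusiveSplitSeq G 0 G
  step : ∀ {n m l} {G : Graph n} {G' : Graph (suc n)} {H : Graph m} →
         IsExclusiveSplit G G' → ExclusiveSplitSeq G' l H →
         ExclusiveSplitSeq G (suc l) H

record Interval : Set where
  field
    lo hi : ℚ
    lo≤hi : lo ℚ.≤ hi
open Interval public

_∈I_ : ℚ → Interval → Set
x ∈I I = (lo I ℚ.≤ x) × (x ℚ.≤ hi I)

Intersect : Interval → Interval → Set
Intersect I J = ∃[ x ] (x ∈I I × x ∈I J)

IsIntersectionModel : ∀ {n} → Graph n → (Fin n → Interval) → Set
IsIntersectionModel {n} G I = (i j : Fin n) → i ≢ j →
  (adj G i j ≡ true → Intersect (I i) (I j)) ×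
  (Intersect (I i) (I j) → adj G i j ≡ true)

IntervalGraph : ∀ {n} → Graph n → Set
IntervalGraph {n} G = ∃[ I ] IsIntersectionModel G I

IsUnit : Interval → Set
IsUnit I = hi I ≡ lo I ℚ.+ 1ℚ

UnitIntervalGraph : ∀ {n} → Graph n → Set
UnitIntervalGraph {n} G =
  Σ (Fin n → Interval) λ I → (∀ i → IsUnit (I i)) × IsIntersectionModel G I

CycAdj : (k : ℕ) → .{{_ : ℕ.NonZero k}} → Fin k → Fin k → Set
CycAdj k i j = (toℕ j ≡ (suc (toℕ i)) % k) ⊎ (toℕ i ≡ (suc (toℕ j)) % k)

InducedCycle : ∀ {n} → Graph n → (k : ℕ) → (Fin (4 + k) → Fin n) → Set
InducedCycle G k c = Injective _≡_ _≡_ c ×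
  (∀ i j → (adj G (c i) (c j) ≡ true → CycAdj (4 + k) i j) ×
           (CycAdj (4 + k) i j → adj G (c i) (c j) ≡ true))

Chordal : ∀ {n} → Graph n → Set
Chordal {n} G = ∀ k (c : Fin (4 + k) → Fin n) → ¬ InducedCycle G k c

data GraphClass : Set where
  interval unitInterval chordal : GraphClass

InClass : GraphClass → ∀ {n} → Graph n → Set
InClass interval     G = IntervalGraph G
InClass unitInterval G = UnitIntervalGraph G
InClass chordal      G = Chordal G

{-# OPTIONS --safe #-}
module Submission where

-- Replace each split (v; A, B) by the exclusive split (v; A ∩ N(v), (B ∖ A) ∩ N(v)) taken in
-- the current spanning subgraph: this gives as many exclusive splits, ending in a spanning
-- subgraph H' of H.  Collapsing the two copies of v is a homomorphism back, so splits keep the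
-- graph triangle-free, and it remains to show that each class is closed under deleting edges
-- from a triangle-free graph, one edge uv at a time.
-- Interval graphs: let I u start first.  Having no triangles forces the intersection of I u and
-- I v to be the only one between a set S and its complement, where S = {v} if I v ⊆ I u, and
-- otherwise S consists of the intervals other than I u starting no earlier than I v.
-- Translating S beyond all other intervals therefore removes exactly that intersection.
-- Chordal graphs: an induced cycle of H − uv must pass through u and v; the chord uv cuts off an
-- arc that would be an edge of the cycle, a triangle, or a shorter induced cycle of H.

open import Defs
open import Data.Nat using (ℕ; _≤_)
open import Data.Product using (Σ; ∃-syntax; _×_)

open import Algebra.Bundles using (CommutativeMonoid)
import Algebra.Properties.CommutativeSemigroup as CommutativeSemigroupProperties
import Algebra.Properties.Group as GroupProperties
open import Data.Bool using (Bool; true; false; not; _∧_; _∨_)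
import Data.Bool.Properties as Bool
open import Data.Empty using (⊥; ⊥-elim)
open import Data.Fin as Fin using (Fin; toℕ; inject₁; fromℕ; fromℕ<; combine; #_)
import Data.Fin.Properties as Fin
open import Data.Fin.Relation.Unary.Top using (view; ‵fromℕ; ‵inject₁; view-fromℕ; view-inject₁)
open import Data.Nat as ℕ using (zero; suc; _+_; _*_; _⊓_; _%_; _<_; _<?_)
import Data.Nat.DivMod as ℕ
import Data.Nat.Properties as ℕ
open import Data.Product using (_,_; proj₁; proj₂)
open import Data.Rational as ℚ using (ℚ; 0ℚ; 1ℚ)
import Data.Rational.Properties as ℚ
open import Data.Sum using (_⊎_; inj₁; inj₂)
open import Function using (id; _∘_)
open import Function.Bundles using (_⇔_; mk⇔; Equivalence)
open import Relation.Binary.PropositionalEquality as ≡ using (_≡_; _≢_; refl; cong; cong₂; trans)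
open import Relation.Nullary using (¬_; Dec; yes; no; contradiction; ¬?; _×-dec_; _⊎-dec_)

open CommutativeSemigroupProperties (CommutativeMonoid.commutativeSemigroup ℚ.+-0-commutativeMonoid)
  using (xy∙z≈xz∙y)
open GroupProperties ℚ.+-0-group using (//-rightDividesʳ; \\-leftDividesˡ)

true≢false : true ≢ false
true≢false ()

Homomorphism : ∀ {n m} → Graph n → Graph m → (Fin n → Fin m) → Set
Homomorphism G H f = ∀ a b → adj G a b ≡ true → adj H (f a) (f b) ≡ true

_⊆_ : ∀ {n} → Graph n → Graph n → Set
K ⊆ G = Homomorphism K G id

⊆-refl : ∀ {n} {G : Graph n} → G ⊆ G
⊆-refl a b e = e

adj⇒≢ : ∀ {n} (G : Graph n) {a b} → adj G a b ≡ true → a ≢ b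
adj⇒≢ G {a} e refl = true≢false (trans (≡.sym e) (irrefl G a))

triangleFree-reflect : ∀ {n m} {G : Graph n} {H : Graph m} (f : Fin n → Fin m) →
                       Homomorphism G H f → TriangleFree H → TriangleFree G
triangleFree-reflect f hom tf i j k ij jk ik =
  tf (f i) (f j) (f k) (hom _ _ ij) (hom _ _ jk) (hom _ _ ik)

-- Splits

collapse : ∀ {n} → Fin n → Fin (suc n) → Fin n
collapse v a with view a
... | ‵fromℕ     = v
... | ‵inject₁ x = x

isTop : ∀ {n} → Fin (suc n) → Bool
isTop a with view a
... | ‵fromℕ     = true
... | ‵inject₁ _ = false

collapse-inject₁ : ∀ {n} (v x : Fin n) → collapse v (inject₁ x) ≡ x
collapse-inject₁ v x rewrite view-inject₁ x = refl

collapse-fromℕ : ∀ {n} (v : Fin n) → collapse v (fromℕ n) ≡ v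
collapse-fromℕ {n} v rewrite view-fromℕ n = refl

isTop-inject₁ : ∀ {n} (x : Fin n) → isTop (inject₁ x) ≡ false
isTop-inject₁ x rewrite view-inject₁ x = refl

isTop-fromℕ : ∀ n → isTop (fromℕ n) ≡ true
isTop-fromℕ n rewrite view-fromℕ n = refl

module _ {n} {G : Graph n} {G' : Graph (suc n)} (s : SplitData G G') where
  open SplitData s

  private
    A⊆N : ∀ y → A y ≡ true → adj G v y ≡ true
    A⊆N y e = trans (≡.sym (union y)) (cong (_∨ B y) e)

    B⊆N : ∀ y → B y ≡ true → adj G v y ≡ true
    B⊆N y e = trans (≡.sym (union y)) (trans (cong (A y ∨_) e) (Bool.∨-zeroʳ (A y)))

    inject₁-adj : ∀ x y → adj G' (inject₁ x) (inject₁ y) ≡ true → adj G x y ≡ true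
    inject₁-adj x y e with x Fin.≟ v | y Fin.≟ v
    ... | yes refl | yes refl = ⊥-elim (adj⇒≢ G' e refl)
    ... | yes refl | no y≢v   = A⊆N y (trans (≡.sym (v₁adj y y≢v)) e)
    ... | no x≢v   | yes refl =
      trans (sym G x v) (A⊆N x (trans (≡.sym (v₁adj x x≢v)) (trans (sym G' _ _) e)))
    ... | no x≢v   | no y≢v   = trans (≡.sym (keep x y x≢v y≢v)) e

    fromℕ-adj : ∀ y → adj G' (fromℕ n) (inject₁ y) ≡ true → adj G v y ≡ true
    fromℕ-adj y e with y Fin.≟ v
    ... | yes refl with () ← trans (≡.sym e) (trans (sym G' _ _) v₁v₂)
    ... | no y≢v = B⊆N y (trans (≡.sym (v₂adj y y≢v)) e)

  collapse-homomorphism : Homomorphism G' G (collapse v)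
  collapse-homomorphism a b e with view a | view b
  ... | ‵fromℕ     | ‵fromℕ     = ⊥-elim (adj⇒≢ G' e refl)
  ... | ‵fromℕ     | ‵inject₁ y = fromℕ-adj y e
  ... | ‵inject₁ x | ‵fromℕ     = trans (sym G x v) (fromℕ-adj x (trans (sym G' _ _) e))
  ... | ‵inject₁ x | ‵inject₁ y = inject₁-adj x y e

triangleFree-splitSeq : ∀ {n m l} {G : Graph n} {H : Graph m} →
                        TriangleFree G → SplitSeq G l H → TriangleFree H
triangleFree-splitSeq tf done = tf
triangleFree-splitSeq {G = G} tf (step {G' = G'} s rest) =
  triangleFree-splitSeq (triangleFree-reflect {G = G'} {G} _ (collapse-homomorphism s) tf) rest

exclusive-union : ∀ a b k → (k ≡ true → (a ∨ b) ≡ true) → ((a ∧ k) ∨ (b ∧ (not a ∧ k))) ≡ k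
exclusive-union true  b     true  _ = refl
exclusive-union false true  true  _ = refl
exclusive-union false false true  h with () ← h refl
exclusive-union true  b     false _ = Bool.∧-zeroʳ b
exclusive-union false b     false _ = Bool.∧-zeroʳ b

exclusive-disjoint : ∀ a b k → ((a ∧ k) ∧ (b ∧ (not a ∧ k))) ≡ false
exclusive-disjoint true  b k = trans (cong (k ∧_) (Bool.∧-zeroʳ b)) (Bool.∧-zeroʳ k)
exclusive-disjoint false b k = refl

∧-implied : ∀ {a b} → (b ≡ true → a ≡ true) → (a ∧ b) ≡ b
∧-implied {a} {false} _ = Bool.∧-zeroʳ a
∧-implied {a} {true}  h = trans (Bool.∧-identityʳ a) (h refl)

module ExclusiveRefinement {n} {G K : Graph n} {G' : Graph (suc n)}
                           (K⊆G : K ⊆ G) (s : SplitData G G') where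
  open SplitData s

  A′ B′ : Subset n
  A′ w = A w ∧ adj K v w
  B′ w = B w ∧ (not (A w) ∧ adj K v w)

  private
    dropped : Fin (suc n) → Fin (suc n) → Bool
    dropped a b = isTop a ∧ A (collapse v b)

    adj′ : Fin (suc n) → Fin (suc n) → Bool
    adj′ a b = adj G' a b ∧ (not (dropped a b ∨ dropped b a) ∧ adj K (collapse v a) (collapse v b))

    irrefl′ : ∀ a → adj′ a a ≡ false
    irrefl′ a rewrite irrefl G' a = refl

  graph : Graph (suc n)
  graph = record
    { adj    = adj′
    ; sym    = λ a b → cong₂ _∧_ (sym G' a b)
                         (cong₂ _∧_ (cong not (Bool.∨-comm (dropped a b) _)) (sym K _ _))
    ; irrefl = irrefl′
    }

  graph⊆G' : graph ⊆ G'
  graph⊆G' a b = Bool.∧-conicalˡ _ _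

  private
    keep′ : ∀ x y → x ≢ v → y ≢ v → adj graph (inject₁ x) (inject₁ y) ≡ adj K x y
    keep′ x y x≢v y≢v
      rewrite isTop-inject₁ x | isTop-inject₁ y | collapse-inject₁ v x | collapse-inject₁ v y
            | keep x y x≢v y≢v = ∧-implied (K⊆G x y)

    v₁adj′ : ∀ y → y ≢ v → adj graph (inject₁ v) (inject₁ y) ≡ A′ y
    v₁adj′ y y≢v
      rewrite isTop-inject₁ v | isTop-inject₁ y | collapse-inject₁ v v | collapse-inject₁ v y
            | v₁adj y y≢v = refl

    v₂adj′ : ∀ y → y ≢ v → adj graph (fromℕ n) (inject₁ y) ≡ B′ y
    v₂adj′ y y≢v
      rewrite isTop-fromℕ n | isTop-inject₁ y | collapse-fromℕ v | collapse-inject₁ v y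
            | v₂adj y y≢v | Bool.∨-identityʳ (A y) = refl

    v₁v₂′ : adj graph (inject₁ v) (fromℕ n) ≡ false
    v₁v₂′ rewrite v₁v₂ = refl

  isExclusiveSplit : IsExclusiveSplit K graph
  isExclusiveSplit = record
    { v     = v
    ; A     = A′
    ; B     = B′
    ; union = λ w → exclusive-union (A w) (B w) (adj K v w) (λ e → trans (union w) (K⊆G v w e))
    ; keep  = keep′
    ; v₁adj = v₁adj′
    ; v₂adj = v₂adj′
    ; v₁v₂  = v₁v₂′
    } , λ w → exclusive-disjoint (A w) (B w) (adj K v w)

exclusiveRefinement : ∀ {n m l} {G K : Graph n} {H : Graph m} → K ⊆ G → SplitSeq G l H →
                      Σ (Graph m) λ H' → ExclusiveSplitSeq K l H' × H' ⊆ H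
exclusiveRefinement {K = K} K⊆G done = K , done , K⊆G
exclusiveRefinement {K = K} K⊆G (step s rest) =
  let H' , rest' , H'⊆H = exclusiveRefinement (graph⊆G' {K = K} K⊆G s) rest
  in  H' , step (isExclusiveSplit K⊆G s) rest' , H'⊆H
  where open ExclusiveRefinement

-- Deleting edges one at a time

SamePair : ∀ {m} → Fin m → Fin m → Fin m → Fin m → Set
SamePair a b u v = (a ≡ u × b ≡ v) ⊎ (a ≡ v × b ≡ u)

samePair-swap : ∀ {m} {a b u v : Fin m} → SamePair a b u v → SamePair b a u v
samePair-swap (inj₁ (a≡u , b≡v)) = inj₂ (b≡v , a≡u)
samePair-swap (inj₂ (a≡v , b≡u)) = inj₁ (b≡u , a≡v)

samePair-flip : ∀ {m} {a b u v : Fin m} → SamePair a b u v → SamePair a b v u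
samePair-flip (inj₁ ab≡uv) = inj₂ ab≡uv
samePair-flip (inj₂ ab≡vu) = inj₁ ab≡vu

samePair-trans : ∀ {m} {a b x y u v : Fin m} → SamePair a b u v → SamePair x y u v → SamePair a b x y
samePair-trans (inj₁ (refl , refl)) (inj₁ (refl , refl)) = inj₁ (refl , refl)
samePair-trans (inj₁ (refl , refl)) (inj₂ (refl , refl)) = inj₂ (refl , refl)
samePair-trans (inj₂ (refl , refl)) (inj₁ (refl , refl)) = inj₂ (refl , refl)
samePair-trans (inj₂ (refl , refl)) (inj₂ (refl , refl)) = inj₁ (refl , refl)

samePair-adj : ∀ {m} (G : Graph m) {a b u v} → SamePair a b u v → adj G a b ≡ adj G u v
samePair-adj G (inj₁ (refl , refl)) = refl
samePair-adj G (inj₂ (refl , refl)) = sym G _ _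

_≈_ : ∀ {m} → Graph m → Graph m → Set
K ≈ K' = ∀ a b → adj K a b ≡ adj K' a b

record DeletesAtMost {m} (K K' : Graph m) (u v : Fin m) : Set where
  field
    subgraph : K' ⊆ K
    retains  : ∀ a b → ¬ SamePair a b u v → adj K a b ≡ true → adj K' a b ≡ true

  avoids : adj K' u v ≡ false → ∀ {a b} → adj K' a b ≡ true → ¬ SamePair a b u v
  avoids uv∉K' e ab≡uv with () ← trans (≡.sym uv∉K') (trans (≡.sym (samePair-adj K' ab≡uv)) e)

  private
    unchanged : (∀ {a b} → SamePair a b u v → adj K a b ≡ true → adj K' a b ≡ false → ⊥) → K ≈ K'
    unchanged changed a b with adj K a b in e | adj K' a b in e'
    ... | true  | true  = refl
    ... | false | false = refl
    ... | false | true  with () ← trans (≡.sym (subgraph a b e')) e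
    ... | true  | false with () ← trans (≡.sym (retains a b (λ ab≡uv → changed ab≡uv e e') e)) e'

  ≈-or-deletes : K ≈ K' ⊎ (adj K u v ≡ true × adj K' u v ≡ false)
  ≈-or-deletes with adj K u v in uv∈K | adj K' u v in uv∈K'
  ... | true  | false = inj₂ (refl , refl)
  ... | true  | true  = inj₁ (unchanged λ ab≡uv _ e' →
    true≢false (trans (≡.sym uv∈K') (trans (≡.sym (samePair-adj K' ab≡uv)) e')))
  ... | false | _     = inj₁ (unchanged λ ab≡uv e _ →
    true≢false (trans (≡.sym e) (trans (samePair-adj K ab≡uv) uv∈K)))

deletesAtMost-flip : ∀ {m} {K K' : Graph m} {u v} → DeletesAtMost K K' u v → DeletesAtMost K K' v u
deletesAtMost-flip D = record
  { subgraph = DeletesAtMost.subgraph D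
  ; retains  = λ a b ¬ab≡vu → DeletesAtMost.retains D a b (¬ab≡vu ∘ samePair-flip)
  }

module Interpolation {m} {H H' : Graph m} (H'⊆H : H' ⊆ H) where
  private
    rank : Fin m → Fin m → ℕ
    rank a b = toℕ (combine a b) ⊓ toℕ (combine b a)

    rank-sym : ∀ a b → rank a b ≡ rank b a
    rank-sym a b = ℕ.⊓-comm (toℕ (combine a b)) (toℕ (combine b a))

    rank-samePair : ∀ {a b u v} → rank a b ≡ toℕ (combine u v) → SamePair a b u v
    rank-samePair {a} {b} {u} {v} eq with ℕ.⊓-sel (toℕ (combine a b)) (toℕ (combine b a))
    ... | inj₁ e = inj₁ (Fin.combine-injective a b u v (Fin.toℕ-injective (trans (≡.sym e) eq)))
    ... | inj₂ e =
      let b≡u , a≡v = Fin.combine-injective b a u v (Fin.toℕ-injective (trans (≡.sym e) eq))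
      in  inj₂ (a≡v , b≡u)

    adjᵗ : ℕ → Fin m → Fin m → Bool
    adjᵗ t a b with rank a b <? t
    ... | yes _ = adj H' a b
    ... | no  _ = adj H a b

    symᵗ : ∀ t a b → adjᵗ t a b ≡ adjᵗ t b a
    symᵗ t a b with rank a b <? t | rank b a <? t
    ... | yes _   | yes _   = sym H' a b
    ... | no  _   | no  _   = sym H a b
    ... | yes ab< | no ba≮  = contradiction (≡.subst (_< t) (rank-sym a b) ab<) ba≮
    ... | no  ab≮ | yes ba< = contradiction (≡.subst (_< t) (rank-sym b a) ba<) ab≮

    irreflᵗ : ∀ t a → adjᵗ t a a ≡ false
    irreflᵗ t a with rank a a <? t
    ... | yes _ = irrefl H' a
    ... | no  _ = irrefl H a

  interpolant : ℕ → Graph m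
  interpolant t = record { adj = adjᵗ t ; sym = symᵗ t ; irrefl = irreflᵗ t }

  interpolant⊆H : ∀ t → interpolant t ⊆ H
  interpolant⊆H t a b e with rank a b <? t
  ... | yes _ = H'⊆H a b e
  ... | no  _ = e

  interpolant-step : ∀ t u v → toℕ (combine u v) ≡ t →
                     DeletesAtMost (interpolant t) (interpolant (suc t)) u v
  interpolant-step t u v uv≡t = record { subgraph = subgraph ; retains = retains }
    where
    subgraph : interpolant (suc t) ⊆ interpolant t
    subgraph a b e with rank a b <? t | rank a b <? suc t
    ... | yes _   | yes _    = e
    ... | yes r<t | no r≮t+1 = contradiction (ℕ.m<n⇒m<1+n r<t) r≮t+1
    ... | no  _   | yes _    = H'⊆H a b e
    ... | no  _   | no  _    = e

    retains : ∀ a b → ¬ SamePair a b u v → adj (interpolant t) a b ≡ true →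
              adj (interpolant (suc t)) a b ≡ true
    retains a b ¬ab≡uv e with rank a b <? t | rank a b <? suc t
    ... | yes _   | yes _    = e
    ... | yes r<t | no r≮t+1 = contradiction (ℕ.m<n⇒m<1+n r<t) r≮t+1
    ... | no  _   | no  _    = e
    ... | no  r≮t | yes r<t+1 with ℕ.m<1+n⇒m<n∨m≡n r<t+1
    ...   | inj₁ r<t = contradiction r<t r≮t
    ...   | inj₂ r≡t = contradiction (rank-samePair (trans r≡t (≡.sym uv≡t))) ¬ab≡uv

  interpolant-final : interpolant (m * m) ≈ H'
  interpolant-final a b with rank a b <? m * m
  ... | yes _    = refl
  ... | no r≮m² = contradiction (ℕ.≤-<-trans (ℕ.m⊓n≤m _ _) (Fin.toℕ<n (combine a b))) r≮m²

⊆-induction : ∀ {m} (P : Graph m → Set) {H H' : Graph m} →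
              (∀ {K K'} → K ≈ K' → P K → P K') →
              (∀ {K K' u v} → K ⊆ H → DeletesAtMost K K' u v → P K → P K') →
              H' ⊆ H → P H → P H'
⊆-induction {m} P {H} {H'} P-≈ P-delete H'⊆H PH =
  P-≈ interpolant-final (interpolants (m * m) ℕ.≤-refl)
  where
  open Interpolation {H = H} {H'} H'⊆H

  interpolants : ∀ t → t ≤ m * m → P (interpolant t)
  interpolants zero    _    = P-≈ (λ _ _ → refl) PH
  interpolants (suc t) t<m² =
    let u , v , uv≡t = Fin.combine-surjective (fromℕ< t<m²)
    in  P-delete (interpolant⊆H t)
                 (interpolant-step t u v (trans (cong toℕ uv≡t) (Fin.toℕ-fromℕ< t<m²)))
                 (interpolants t (ℕ.<⇒≤ t<m²))

-- Interval graphs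

intersect⇒ : ∀ I J → Intersect I J → lo I ℚ.≤ hi J × lo J ℚ.≤ hi I
intersect⇒ _ _ (x , (loI≤x , x≤hiI) , (loJ≤x , x≤hiJ)) = ℚ.≤-trans loI≤x x≤hiJ , ℚ.≤-trans loJ≤x x≤hiI

intersect⇐ : ∀ I J → lo I ℚ.≤ hi J → lo J ℚ.≤ hi I → Intersect I J
intersect⇐ I J loI≤hiJ loJ≤hiI with ℚ.≤-total (lo I) (lo J)
... | inj₁ loI≤loJ = lo J , (loI≤loJ , loJ≤hiI) , (ℚ.≤-refl , lo≤hi J)
... | inj₂ loJ≤loI = lo I , (ℚ.≤-refl , lo≤hi I) , (loJ≤loI , loI≤hiJ)

intersect-sym : ∀ I J → Intersect I J → Intersect J I
intersect-sym _ _ (x , x∈I , x∈J) = x , x∈J , x∈I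

disjoint : ∀ I J → hi I ℚ.< lo J → ¬ Intersect I J
disjoint I J hiI<loJ x = ℚ.<-irrefl refl (ℚ.<-≤-trans hiI<loJ (proj₂ (intersect⇒ I J x)))

translate : ℚ → Interval → Interval
translate δ I = record { lo = lo I ℚ.+ δ ; hi = hi I ℚ.+ δ ; lo≤hi = ℚ.+-monoˡ-≤ δ (lo≤hi I) }

translate-isUnit : ∀ δ I → IsUnit I → IsUnit (translate δ I)
translate-isUnit δ I unit = trans (cong (ℚ._+ δ) unit) (xy∙z≈xz∙y (lo I) 1ℚ δ)

+-cancelʳ-≤ : ∀ δ {p q} → p ℚ.+ δ ℚ.≤ q ℚ.+ δ → p ℚ.≤ q
+-cancelʳ-≤ δ {p} {q} =
  ≡.subst₂ ℚ._≤_ (//-rightDividesʳ δ p) (//-rightDividesʳ δ q) ∘ ℚ.+-monoˡ-≤ (ℚ.- δ)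

translate-intersect : ∀ δ I J → Intersect (translate δ I) (translate δ J) ⇔ Intersect I J
translate-intersect δ I J = mk⇔
  (λ x → let loI≤hiJ , loJ≤hiI = intersect⇒ (translate δ I) (translate δ J) x
         in  intersect⇐ I J (+-cancelʳ-≤ δ loI≤hiJ) (+-cancelʳ-≤ δ loJ≤hiI))
  (λ x → let loI≤hiJ , loJ≤hiI = intersect⇒ I J x
         in  intersect⇐ (translate δ I) (translate δ J)
                        (ℚ.+-monoˡ-≤ δ loI≤hiJ) (ℚ.+-monoˡ-≤ δ loJ≤hiI))

translateWhen : ∀ {P : Set} → Dec P → ℚ → Interval → Interval
translateWhen (yes _) δ I = translate δ I
translateWhen (no  _) _ I = I

translateWhen-isUnit : ∀ {P : Set} (P? : Dec P) δ I → IsUnit I → IsUnit (translateWhen P? δ I)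
translateWhen-isUnit (yes _) δ I = translate-isUnit δ I
translateWhen-isUnit (no  _) δ I = id

maxHi : ∀ {m} → (Fin m → Interval) → ℚ
maxHi {zero}  I = 0ℚ
maxHi {suc m} I = hi (I Fin.zero) ℚ.⊔ maxHi (I ∘ Fin.suc)

hi≤maxHi : ∀ {m} (I : Fin m → Interval) w → hi (I w) ℚ.≤ maxHi I
hi≤maxHi I Fin.zero    = ℚ.p≤p⊔q (hi (I Fin.zero)) _
hi≤maxHi I (Fin.suc w) = ℚ.≤-trans (hi≤maxHi (I ∘ Fin.suc) w) (ℚ.p≤q⊔p (hi (I Fin.zero)) _)

beyond : ∀ {a p x M} → a ℚ.≤ p → x ℚ.≤ M → x ℚ.< p ℚ.+ (ℚ.- a ℚ.+ (M ℚ.+ 1ℚ))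
beyond {a} {p} {x} {M} a≤p x≤M = begin-strict
  x                            ≤⟨ x≤M ⟩
  M                            ≡⟨ ≡.sym (ℚ.+-identityʳ M) ⟩
  M ℚ.+ 0ℚ                     <⟨ ℚ.+-monoʳ-< M (ℚ.positive⁻¹ 1ℚ) ⟩
  M ℚ.+ 1ℚ                     ≡⟨ ≡.sym (\\-leftDividesˡ a (M ℚ.+ 1ℚ)) ⟩
  a ℚ.+ (ℚ.- a ℚ.+ (M ℚ.+ 1ℚ)) ≤⟨ ℚ.+-monoˡ-≤ _ a≤p ⟩
  p ℚ.+ (ℚ.- a ℚ.+ (M ℚ.+ 1ℚ)) ∎
  where open ℚ.≤-Reasoning

-- Translating S far to the right destroys exactly the intersection of I u and I v.
record Cut {m} (I : Fin m → Interval) (S : Fin m → Set) (u v : Fin m) : Set where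
  field
    u∉S      : ¬ S u
    v∈S      : S v
    crossing : ∀ {i j} → ¬ S i → S j → Intersect (I i) (I j) → i ≡ u × j ≡ v

module CutTranslation {m} {I : Fin m → Interval} {S : Fin m → Set} {u v : Fin m}
                      (S? : ∀ w → Dec (S w)) (cut : Cut I S u v) (δ : ℚ)
                      (far : ∀ i j → S j → hi (I i) ℚ.< lo (I j) ℚ.+ δ) where
  open Cut cut

  I′ : Fin m → Interval
  I′ w = translateWhen (S? w) δ (I w)

  I′-isUnit : ∀ w → IsUnit (I w) → IsUnit (I′ w)
  I′-isUnit w = translateWhen-isUnit (S? w) δ (I w)

  intersect-I′ : ∀ i j → Intersect (I′ i) (I′ j) ⇔ (Intersect (I i) (I j) × ¬ SamePair i j u v)
  intersect-I′ i j with S? i | S? j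
  ... | yes i∈S | yes j∈S =
    mk⇔ (λ x → Equivalence.to (translate-intersect δ (I i) (I j)) x , ¬uv)
        (Equivalence.from (translate-intersect δ (I i) (I j)) ∘ proj₁)
    where
    ¬uv : ¬ SamePair i j u v
    ¬uv (inj₁ (refl , _)) = u∉S i∈S
    ¬uv (inj₂ (_ , refl)) = u∉S j∈S
  ... | no i∉S | no j∉S =
    mk⇔ (λ x → x , ¬uv) proj₁
    where
    ¬uv : ¬ SamePair i j u v
    ¬uv (inj₁ (_ , refl)) = j∉S v∈S
    ¬uv (inj₂ (refl , _)) = i∉S v∈S
  ... | no i∉S | yes j∈S =
    mk⇔ (λ x → ⊥-elim (disjoint (I i) (translate δ (I j)) (far i j j∈S) x))
        (λ (x , ¬uv) → ⊥-elim (¬uv (inj₁ (crossing i∉S j∈S x))))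
  ... | yes i∈S | no j∉S =
    mk⇔ (λ x → ⊥-elim (disjoint (I j) (translate δ (I i)) (far j i i∈S)
                         (intersect-sym (translate δ (I i)) (I j) x)))
        (λ (x , ¬uv) → let j≡u , i≡v = crossing j∉S i∈S (intersect-sym (I i) (I j) x)
                       in  ⊥-elim (¬uv (inj₂ (i≡v , j≡u))))

UnitPreservingModel : ∀ {m} → Graph m → (Fin m → Interval) → Set
UnitPreservingModel {m} K I =
  Σ (Fin m → Interval) λ I′ → IsIntersectionModel K I′ × (∀ w → IsUnit (I w) → IsUnit (I′ w))

module _ {m} {K : Graph m} {I : Fin m → Interval}
         (tf : TriangleFree K) (model : IsIntersectionModel K I) where

  noCommonPoint : ∀ {a b c x} → a ≢ b → b ≢ c → a ≢ c →
                  x ∈I I a → x ∈I I b → x ∈I I c → ⊥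
  noCommonPoint a≢b b≢c a≢c x∈a x∈b x∈c =
    tf _ _ _ (edge a≢b x∈a x∈b) (edge b≢c x∈b x∈c) (edge a≢c x∈a x∈c)
    where
    edge : ∀ {i j x} → i ≢ j → x ∈I I i → x ∈I I j → adj K i j ≡ true
    edge i≢j x∈i x∈j = proj₂ (model _ _ i≢j) (_ , x∈i , x∈j)

  module _ {u v : Fin m} (u≢v : u ≢ v) (loU≤loV : lo (I u) ℚ.≤ lo (I v)) where

    crossingCut : lo (I v) ℚ.≤ hi (I u) → hi (I u) ℚ.≤ hi (I v) →
                  Cut I (λ w → w ≢ u × lo (I v) ℚ.≤ lo (I w)) u v
    crossingCut loV≤hiU hiU≤hiV = record
      { u∉S      = λ (u≢u , _) → u≢u refl
      ; v∈S      = u≢v ∘ ≡.sym , ℚ.≤-refl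
      ; crossing = crossing
      }
      where
      crossing : ∀ {i j} → ¬ (i ≢ u × lo (I v) ℚ.≤ lo (I i)) → j ≢ u × lo (I v) ℚ.≤ lo (I j) →
                 Intersect (I i) (I j) → i ≡ u × j ≡ v
      crossing {i} {j} i∉S (j≢u , loV≤loJ) (x , (loI≤x , x≤hiI) , (loJ≤x , _))
        with i Fin.≟ u | j Fin.≟ v
      ... | yes i≡u  | yes j≡v = i≡u , j≡v
      ... | yes refl | no j≢v  =
        ⊥-elim (noCommonPoint u≢v (j≢v ∘ ≡.sym) (j≢u ∘ ≡.sym)
                  (ℚ.≤-trans loU≤loV loV≤loJ , loJ≤hiU) (loV≤loJ , ℚ.≤-trans loJ≤hiU hiU≤hiV)
                  (ℚ.≤-refl , lo≤hi (I j)))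
        where
        loJ≤hiU : lo (I j) ℚ.≤ hi (I u)
        loJ≤hiU = ℚ.≤-trans loJ≤x x≤hiI
      ... | no i≢u | _ =
        ⊥-elim (noCommonPoint i≢u u≢v i≢v
                  (ℚ.<⇒≤ (ℚ.≰⇒> (λ loV≤loI → i∉S (i≢u , loV≤loI))) ,
                   ℚ.≤-trans loV≤loJ (ℚ.≤-trans loJ≤x x≤hiI))
                  (loU≤loV , loV≤hiU) (ℚ.≤-refl , lo≤hi (I v)))
        where
        i≢v : i ≢ v
        i≢v refl = i∉S (u≢v ∘ ≡.sym , ℚ.≤-refl)

    nestedCut : hi (I v) ℚ.≤ hi (I u) → Cut I (_≡ v) u v
    nestedCut hiV≤hiU = record
      { u∉S      = u≢v
      ; v∈S      = refl
      ; crossing = crossing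
      }
      where
      crossing : ∀ {i j} → i ≢ v → j ≡ v → Intersect (I i) (I j) → i ≡ u × j ≡ v
      crossing {i} i≢v refl (x , x∈i , (loV≤x , x≤hiV)) with i Fin.≟ u
      ... | yes i≡u = i≡u , refl
      ... | no  i≢u = ⊥-elim (noCommonPoint i≢u u≢v i≢v x∈i
                        (ℚ.≤-trans loU≤loV loV≤x , ℚ.≤-trans x≤hiV hiV≤hiU) (loV≤x , x≤hiV))

  private
    fromCut : ∀ {K' u v} {S : Fin m → Set} → DeletesAtMost K K' u v → adj K' u v ≡ false →
              (∀ w → Dec (S w)) → Cut I S u v → (∀ j → S j → lo (I v) ℚ.≤ lo (I j)) →
              UnitPreservingModel K' I
    fromCut {K'} {v = v} D uv∉K' S? cut S-right = I′ , model′ , I′-isUnit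
      where
      open DeletesAtMost D
      open CutTranslation S? cut (ℚ.- lo (I v) ℚ.+ (maxHi I ℚ.+ 1ℚ))
                          (λ i j j∈S → beyond (S-right j j∈S) (hi≤maxHi I i))

      model′ : IsIntersectionModel K' I′
      model′ i j i≢j =
        (λ e → Equivalence.from (intersect-I′ i j)
                 (proj₁ (model i j i≢j) (subgraph i j e) , avoids uv∉K' e)) ,
        (λ x → let x₀ , ¬uv = Equivalence.to (intersect-I′ i j) x
               in  retains i j ¬uv (proj₂ (model i j i≢j) x₀))

    deleteEdge-ordered : ∀ {K' u v} → DeletesAtMost K K' u v → adj K u v ≡ true → adj K' u v ≡ false →
                         lo (I u) ℚ.≤ lo (I v) → UnitPreservingModel K' I
    deleteEdge-ordered {K'} {u} {v} D uv∈K uv∉K' loU≤loV with ℚ.≤-total (hi (I u)) (hi (I v))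
    ... | inj₁ hiU≤hiV =
      fromCut D uv∉K' (λ w → ¬? (w Fin.≟ u) ×-dec (lo (I v) ℚ.≤? lo (I w)))
              (crossingCut {u} {v} (adj⇒≢ K uv∈K) loU≤loV loV≤hiU hiU≤hiV) (λ _ → proj₂)
      where
      loV≤hiU : lo (I v) ℚ.≤ hi (I u)
      loV≤hiU = proj₂ (intersect⇒ (I u) (I v) (proj₁ (model u v (adj⇒≢ K uv∈K)) uv∈K))
    ... | inj₂ hiV≤hiU =
      fromCut D uv∉K' (Fin._≟ v) (nestedCut {u} {v} (adj⇒≢ K uv∈K) loU≤loV hiV≤hiU)
              (λ { _ refl → ℚ.≤-refl })

  intervalModel-deleteEdge : ∀ {K' u v} → DeletesAtMost K K' u v → adj K u v ≡ true →
                             adj K' u v ≡ false → UnitPreservingModel K' I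
  intervalModel-deleteEdge {K'} {u} {v} D uv∈K uv∉K' with ℚ.≤-total (lo (I u)) (lo (I v))
  ... | inj₁ loU≤loV = deleteEdge-ordered D uv∈K uv∉K' loU≤loV
  ... | inj₂ loV≤loU = deleteEdge-ordered (deletesAtMost-flip D) (trans (sym K v u) uv∈K)
                                          (trans (sym K' v u) uv∉K') loV≤loU

-- Chordal graphs

Next : ℕ → ℕ → ℕ → Set
Next L x y = y ≡ suc x ⊎ (suc x ≡ L × y ≡ 0)

CycAdjℕ : ℕ → ℕ → ℕ → Set
CycAdjℕ L x y = Next L x y ⊎ Next L y x

module _ {L : ℕ} where

  next⇒≡suc% : ∀ {x y} → y < suc L → Next (suc L) x y → y ≡ suc x % suc L
  next⇒≡suc% y<L (inj₁ refl)           = ≡.sym (ℕ.m<n⇒m%n≡m y<L)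
  next⇒≡suc% _   (inj₂ (x+1≡L , refl)) = ≡.sym (trans (cong (_% suc L) x+1≡L) (ℕ.n%n≡0 (suc L)))

  ≡suc%⇒next : ∀ {x y} → x < suc L → y ≡ suc x % suc L → Next (suc L) x y
  ≡suc%⇒next x<L y≡ with ℕ.m≤n⇒m<n∨m≡n x<L
  ... | inj₁ x+1<L = inj₁ (trans y≡ (ℕ.m<n⇒m%n≡m x+1<L))
  ... | inj₂ x+1≡L = inj₂ (x+1≡L , trans y≡ (trans (cong (_% suc L) x+1≡L) (ℕ.n%n≡0 (suc L))))

  cycAdj⇔cycAdjℕ : ∀ (i j : Fin (suc L)) → CycAdj (suc L) i j ⇔ CycAdjℕ (suc L) (toℕ i) (toℕ j)
  cycAdj⇔cycAdjℕ i j = mk⇔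
    (λ { (inj₁ e) → inj₁ (≡suc%⇒next (Fin.toℕ<n i) e) ; (inj₂ e) → inj₂ (≡suc%⇒next (Fin.toℕ<n j) e) })
    (λ { (inj₁ n) → inj₁ (next⇒≡suc% (Fin.toℕ<n j) n) ; (inj₂ n) → inj₂ (next⇒≡suc% (Fin.toℕ<n i) n) })

Consecutive : ℕ → ℕ → Set
Consecutive S T = T ≡ suc S ⊎ S ≡ suc T

Ends : ℕ → ℕ → ℕ → Set
Ends d S T = (S ≡ 0 × T ≡ d) ⊎ (S ≡ d × T ≡ 0)

ends? : ∀ d S T → Dec (Ends d S T)
ends? d S T = (S ℕ.≟ 0 ×-dec T ℕ.≟ d) ⊎-dec (S ℕ.≟ d ×-dec T ℕ.≟ 0)

ends⇒cycAdjℕ : ∀ {d S T} → Ends d S T → CycAdjℕ (suc d) S T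
ends⇒cycAdjℕ (inj₁ (S≡0 , T≡d)) = inj₂ (inj₂ (cong suc T≡d , S≡0))
ends⇒cycAdjℕ (inj₂ (S≡d , T≡0)) = inj₁ (inj₂ (cong suc S≡d , T≡0))

next-on-arc : ∀ {L P d S T} → S ≤ d → P + d < L → Next L (P + S) (P + T) → T ≡ suc S ⊎ (S ≡ d × T ≡ 0)
next-on-arc {P = P} {S = S} _ _ (inj₁ e) = inj₁ (ℕ.+-cancelˡ-≡ P _ _ (trans e (≡.sym (ℕ.+-suc P S))))
next-on-arc {P = P} {d} {S} S≤d P+d<L (inj₂ (P+S+1≡L , P+T≡0)) =
  inj₂ (ℕ.≤-antisym S≤d d≤S , ℕ.m+n≡0⇒n≡0 P P+T≡0)
  where
  d≤S : d ≤ S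
  d≤S = ℕ.+-cancelˡ-≤ P _ _ (ℕ.≤-pred (≡.subst (P + d <_) (≡.sym P+S+1≡L) P+d<L))

cycAdj-on-arc : ∀ {L P d} (i j : Fin (suc L)) {S T} → S ≤ d → T ≤ d → P + d < suc L →
                toℕ i ≡ P + S → toℕ j ≡ P + T → ¬ Ends d S T →
                CycAdj (suc L) i j ⇔ Consecutive S T
cycAdj-on-arc {L} {P} i j {S} {T} S≤d T≤d P+d<L i≡P+S j≡P+T ¬ends = mk⇔
  (λ a → to (≡.subst₂ (CycAdjℕ (suc L)) i≡P+S j≡P+T (Equivalence.to (cycAdj⇔cycAdjℕ i j) a)))
  (λ a → Equivalence.from (cycAdj⇔cycAdjℕ i j)
           (≡.subst₂ (CycAdjℕ (suc L)) (≡.sym i≡P+S) (≡.sym j≡P+T) (from a)))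
  where
  to : CycAdjℕ (suc L) (P + S) (P + T) → Consecutive S T
  to (inj₁ n) with next-on-arc S≤d P+d<L n
  ... | inj₁ T≡S+1       = inj₁ T≡S+1
  ... | inj₂ (S≡d , T≡0) = ⊥-elim (¬ends (inj₂ (S≡d , T≡0)))
  to (inj₂ n) with next-on-arc T≤d P+d<L n
  ... | inj₁ S≡T+1       = inj₂ S≡T+1
  ... | inj₂ (T≡d , S≡0) = ⊥-elim (¬ends (inj₁ (S≡0 , T≡d)))

  from : Consecutive S T → CycAdjℕ (suc L) (P + S) (P + T)
  from (inj₁ T≡S+1) = inj₁ (inj₁ (trans (cong (P +_) T≡S+1) (ℕ.+-suc P S)))
  from (inj₂ S≡T+1) = inj₂ (inj₁ (trans (cong (P +_) S≡T+1) (ℕ.+-suc P T)))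

module ChordalDeletion {m} {K K' : Graph m} {u v : Fin m}
                       (tf : TriangleFree K) (chordalK : Chordal K) (D : DeletesAtMost K K' u v)
                       (uv∈K : adj K u v ≡ true) (uv∉K' : adj K' u v ≡ false)
                       {k} {c : Fin (4 + k) → Fin m} (cycle : InducedCycle K' k c) where
  open DeletesAtMost D

  private
    c-injective : ∀ {i j} → c i ≡ c j → i ≡ j
    c-injective = proj₁ cycle

    c-edge : ∀ i j → (adj K' (c i) (c j) ≡ true → CycAdj (4 + k) i j) ×
                     (CycAdj (4 + k) i j → adj K' (c i) (c j) ≡ true)
    c-edge = proj₂ cycle

  avoiding : (∀ i j → ¬ SamePair (c i) (c j) u v) → ⊥
  avoiding ¬uv = chordalK k c (c-injective , λ i j →
    (λ e → proj₁ (c-edge i j) (retains _ _ (¬uv i j) e)) ,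
    (λ a → subgraph _ _ (proj₂ (c-edge i j) a)))

  -- The chord uv cuts off the arc c p, c (p + 1), …, c q of d edges, a cycle of K together with uv.
  module Arc {p q : Fin (4 + k)} (pq : SamePair (c p) (c q) u v)
             (d : ℕ) (P+d≡Q : toℕ p + d ≡ toℕ q) where
    private
      P : ℕ
      P = toℕ p

      P+d<L : P + d < 4 + k
      P+d<L = ≡.subst (_< 4 + k) (≡.sym P+d≡Q) (Fin.toℕ<n q)

      ≤d : ∀ (t : Fin (suc d)) → toℕ t ≤ d
      ≤d t = ℕ.≤-pred (Fin.toℕ<n t)

      index : Fin (suc d) → Fin (4 + k)
      index t = fromℕ< (ℕ.≤-<-trans (ℕ.+-monoʳ-≤ P (≤d t)) P+d<L)

      toℕ-index : ∀ t → toℕ (index t) ≡ P + toℕ t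
      toℕ-index t = Fin.toℕ-fromℕ< _

    arc : Fin (suc d) → Fin m
    arc = c ∘ index

    arc-injective : ∀ {s t} → arc s ≡ arc t → s ≡ t
    arc-injective {s} {t} e = Fin.toℕ-injective (ℕ.+-cancelˡ-≡ P _ _
      (trans (≡.sym (toℕ-index s)) (trans (cong toℕ (c-injective e)) (toℕ-index t))))

    private
      arc≡cp⇒0 : ∀ {t} → arc t ≡ c p → toℕ t ≡ 0
      arc≡cp⇒0 {t} e = ℕ.+-cancelˡ-≡ P _ _
        (trans (≡.sym (toℕ-index t)) (trans (cong toℕ (c-injective e)) (≡.sym (ℕ.+-identityʳ P))))

      arc≡cq⇒d : ∀ {t} → arc t ≡ c q → toℕ t ≡ d
      arc≡cq⇒d {t} e = ℕ.+-cancelˡ-≡ P _ _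
        (trans (≡.sym (toℕ-index t)) (trans (cong toℕ (c-injective e)) (≡.sym P+d≡Q)))

      arc-start : ∀ {t} → toℕ t ≡ 0 → arc t ≡ c p
      arc-start {t} t≡0 =
        cong c (Fin.toℕ-injective (trans (toℕ-index t) (trans (cong (P +_) t≡0) (ℕ.+-identityʳ P))))

      arc-end : ∀ {t} → toℕ t ≡ d → arc t ≡ c q
      arc-end {t} t≡d =
        cong c (Fin.toℕ-injective (trans (toℕ-index t) (trans (cong (P +_) t≡d) P+d≡Q)))

      samePair⇒ends : ∀ s t → SamePair (arc s) (arc t) u v → Ends d (toℕ s) (toℕ t)
      samePair⇒ends s t st≡uv with samePair-trans st≡uv pq
      ... | inj₁ (s≡p , t≡q) = inj₁ (arc≡cp⇒0 s≡p , arc≡cq⇒d t≡q)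
      ... | inj₂ (s≡q , t≡p) = inj₂ (arc≡cq⇒d s≡q , arc≡cp⇒0 t≡p)

      ends⇒edge : ∀ s t → Ends d (toℕ s) (toℕ t) → adj K (arc s) (arc t) ≡ true
      ends⇒edge s t (inj₁ (s≡0 , t≡d)) rewrite arc-start s≡0 | arc-end t≡d =
        trans (samePair-adj K pq) uv∈K
      ends⇒edge s t (inj₂ (s≡d , t≡0)) rewrite arc-end s≡d | arc-start t≡0 =
        trans (samePair-adj K (samePair-swap pq)) uv∈K

    arc-edge : ∀ s t → (adj K (arc s) (arc t) ≡ true → CycAdj (suc d) s t) ×
                       (CycAdj (suc d) s t → adj K (arc s) (arc t) ≡ true)
    arc-edge s t with ends? d (toℕ s) (toℕ t)
    ... | yes ends =
      (λ _ → Equivalence.from (cycAdj⇔cycAdjℕ s t) (ends⇒cycAdjℕ ends)) , (λ _ → ends⇒edge s t ends)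
    ... | no ¬ends =
      (λ e → Equivalence.from onArc (Equivalence.to onCycle
               (proj₁ (c-edge _ _) (retains _ _ (¬ends ∘ samePair⇒ends s t) e)))) ,
      (λ a → subgraph _ _ (proj₂ (c-edge _ _) (Equivalence.from onCycle (Equivalence.to onArc a))))
      where
      onCycle : CycAdj (4 + k) (index s) (index t) ⇔ Consecutive (toℕ s) (toℕ t)
      onCycle =
        cycAdj-on-arc (index s) (index t) (≤d s) (≤d t) P+d<L (toℕ-index s) (toℕ-index t) ¬ends

      onArc : CycAdj (suc d) s t ⇔ Consecutive (toℕ s) (toℕ t)
      onArc = cycAdj-on-arc {P = 0} s t (≤d s) (≤d t) ℕ.≤-refl refl refl ¬ends

  chord : ∀ {p q} → SamePair (c p) (c q) u v → ∀ d → toℕ p + d ≡ toℕ q → ⊥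
  chord {p} pq zero P+0≡Q with Fin.toℕ-injective (trans (≡.sym (ℕ.+-identityʳ (toℕ p))) P+0≡Q)
  ... | refl = adj⇒≢ K (trans (samePair-adj K pq) uv∈K) refl
  chord {p} {q} pq 1 P+1≡Q =
    avoids uv∉K' (proj₂ (c-edge p q) (Equivalence.from (cycAdj⇔cycAdjℕ p q)
      (inj₁ (inj₁ (trans (≡.sym P+1≡Q) (ℕ.+-comm (toℕ p) 1)))))) pq
  chord pq 2 P+2≡Q = tf (arc (# 0)) (arc (# 1)) (arc (# 2))
    (proj₂ (arc-edge _ _) (inj₁ refl)) (proj₂ (arc-edge _ _) (inj₁ refl))
    (proj₂ (arc-edge _ _) (inj₂ refl))
    where open Arc pq 2 P+2≡Q
  chord pq (suc (suc (suc k'))) P+d≡Q = chordalK k' arc (arc-injective , arc-edge)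
    where open Arc pq (3 + k') P+d≡Q

  absurd : ⊥
  absurd with Fin.any? (λ i → c i Fin.≟ u) | Fin.any? (λ j → c j Fin.≟ v)
  ... | yes (p , cp≡u) | yes (q , cq≡v) with ℕ.≤-total (toℕ p) (toℕ q)
  ...   | inj₁ P≤Q = let d , P+d≡Q = ℕ.m≤n⇒∃[o]m+o≡n P≤Q in chord (inj₁ (cp≡u , cq≡v)) d P+d≡Q
  ...   | inj₂ Q≤P = let d , Q+d≡P = ℕ.m≤n⇒∃[o]m+o≡n Q≤P in chord (inj₂ (cq≡v , cp≡u)) d Q+d≡P
  absurd | no u∉c | _ = avoiding λ where
    i j (inj₁ (ci≡u , _)) → u∉c (i , ci≡u)
    i j (inj₂ (_ , cj≡u)) → u∉c (j , cj≡u)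
  absurd | yes _ | no v∉c = avoiding λ where
    i j (inj₁ (_ , cj≡v)) → v∉c (j , cj≡v)
    i j (inj₂ (ci≡v , _)) → v∉c (i , ci≡v)

chordal-deleteEdge : ∀ {m} {K K' : Graph m} {u v} → TriangleFree K → Chordal K →
                     DeletesAtMost K K' u v → adj K u v ≡ true → adj K' u v ≡ false → Chordal K'
chordal-deleteEdge tf chordalK D uv∈K uv∉K' k c cycle =
  ChordalDeletion.absurd tf chordalK D uv∈K uv∉K' cycle

-- The three classes

model-≈ : ∀ {m} {K K' : Graph m} → K ≈ K' → ∀ I → IsIntersectionModel K I → IsIntersectionModel K' I
model-≈ K≈K' I model i j i≢j =
  (λ e → proj₁ (model i j i≢j) (trans (K≈K' i j) e)) ,
  (λ x → trans (≡.sym (K≈K' i j)) (proj₂ (model i j i≢j) x))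

inClass-≈ : ∀ C {m} {K K' : Graph m} → K ≈ K' → InClass C K → InClass C K'
inClass-≈ interval     {K = K} {K'} K≈K' (I , model) = I , model-≈ {K = K} {K'} K≈K' I model
inClass-≈ unitInterval {K = K} {K'} K≈K' (I , unit , model) =
  I , unit , model-≈ {K = K} {K'} K≈K' I model
inClass-≈ chordal K≈K' chordalK k c (c-injective , c-edge) = chordalK k c (c-injective , λ i j →
  (λ e → proj₁ (c-edge i j) (trans (≡.sym (K≈K' _ _)) e)) ,
  (λ a → trans (K≈K' _ _) (proj₂ (c-edge i j) a)))

inClass-deleteEdge : ∀ C {m} {K K' : Graph m} {u v} → TriangleFree K → DeletesAtMost K K' u v →
                     adj K u v ≡ true → adj K' u v ≡ false → InClass C K → InClass C K'
inClass-deleteEdge interval tf D uv∈K uv∉K' (I , model) =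
  let I′ , model′ , _ = intervalModel-deleteEdge {I = I} tf model D uv∈K uv∉K'
  in  I′ , model′
inClass-deleteEdge unitInterval tf D uv∈K uv∉K' (I , unit , model) =
  let I′ , model′ , unit′ = intervalModel-deleteEdge {I = I} tf model D uv∈K uv∉K'
  in  I′ , (λ w → unit′ w (unit w)) , model′
inClass-deleteEdge chordal tf D uv∈K uv∉K' chordalK = chordal-deleteEdge tf chordalK D uv∈K uv∉K'

inClass-deletesAtMost : ∀ C {m} {K K' : Graph m} {u v} → TriangleFree K → DeletesAtMost K K' u v →
                        InClass C K → InClass C K'
inClass-deletesAtMost C tf D with DeletesAtMost.≈-or-deletes D
... | inj₁ K≈K'            = inClass-≈ C K≈K'
... | inj₂ (uv∈K , uv∉K') = inClass-deleteEdge C tf D uv∈K uv∉K'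

inClass-⊆ : ∀ C {m} {H H' : Graph m} → TriangleFree H → H' ⊆ H → InClass C H → InClass C H'
inClass-⊆ C {H = H} tf = ⊆-induction (InClass C) (inClass-≈ C) λ {K} K⊆H →
  inClass-deletesAtMost C (triangleFree-reflect {G = K} {H} id K⊆H tf)

lemma2 : (C : GraphClass) {n m : ℕ} (G : Graph n) (H : Graph m) (l : ℕ) →
    TriangleFree G → SplitSeq G l H → InClass C H →
    ∃[ l' ] ∃[ m' ] Σ (Graph m') λ H' →
      (l' ≤ l) × ExclusiveSplitSeq G l' H' × InClass C H'
lemma2 C G H l tf seq h =
  let H' , seq' , H'⊆H = exclusiveRefinement (⊆-refl {G = G}) seq
  in  l , _ , H' , ℕ.≤-refl , seq' , inClass-⊆ C (triangleFree-splitSeq tf seq) H'⊆H h
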